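{- Let $(L_n)_{n\ge 0}$ be the Lucas sequence. For a natural number $N$, call a finite set $I\subseteq\{0,1,2,\ldots\}$ a non-consecutive partition of $N$ if no two elements of $I$ are consecutive integers and $\sum_{i\in I}L_i=N$ (here $L_0$ and $L_2$ are allowed to appear simultaneously, i.e. $I$ may contain both $0$ and $2$). Then every natural number has at most two distinct non-consecutive partitions.
   Context: The Lucas sequence is defined by $L_0=2$, $L_1=1$, and $L_n=L_{n-1}+L_{n-2}$ for $n\ge 2$. -}

module Defs where

open import Data.Nat using (ℕ; zero; suc; _+_; _<_)
open import Data.List using (List; map)
open import Data.Nat.ListAction using (sum)
open import Data.List.Relation.Unary.Linked using (Linked)
open import Data.List.Membership.Propositional using (_∈_)
open import Relation.Binary.PropositionalEquality using (_≡_)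
open import Relation.Nullary using (¬_)
open import Data.Product using (_×_)

L : ℕ → ℕ
L 0 = 2
L 1 = 1
L (suc (suc n)) = L (suc n) + L n

-- A finite subset of ℕ, canonically represented as a strictly increasing list.
IsFinSet : List ℕ → Set
IsFinSet I = Linked _<_ I

NonConsecutive : List ℕ → Set
NonConsecutive I = ∀ {i} → i ∈ I → ¬ (suc i ∈ I)

NonConsecutivePartition : ℕ → List ℕ → Set
NonConsecutivePartition N I =
  IsFinSet I × NonConsecutive I × sum (map L I) ≡ N

-- Lucas numbers with positive indices behave like Fibonacci numbers in
-- Zeckendorf's theorem: a sum of L i over indices i ≥ 1 that pairwise differ by
-- at least two is smaller than L (m + 1), where m is the largest index, so
-- comparing largest indices shows that such a sum determines its index set.
-- A non-consecutive partition that contains 0 consists of 0 together with a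
-- partition of N ∸ 2 into positive indices, so there is at most one partition
-- containing 0 and at most one avoiding it.
module Submission where

open import Defs
open import Data.Bool using (Bool; true; false)
open import Data.Nat using (ℕ; zero; suc; _+_; _<_; _≤_; _≤′_; z≤n; s≤s; z<s; ≤′-refl; ≤′-step)
open import Data.Nat.Properties
open import Data.Nat.ListAction using (sum)
open import Data.Nat.ListAction.Properties using (sum-↭)
open import Data.List using (List; []; _∷_; map; reverse)
open import Data.List.Properties using (unfold-reverse; reverse-injective)
open import Data.List.Relation.Unary.All as All using (All; []; _∷_)
open import Data.List.Relation.Unary.AllPairs using (AllPairs; []; _∷_)
import Data.List.Relation.Unary.AllPairs.Properties as AllPairs
open import Data.List.Relation.Unary.Any using (here; there)
open import Data.List.Relation.Unary.Any.Properties using (reverse⁻)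
open import Data.List.Relation.Unary.Linked as Linked using (Linked; []; [-]; _∷_)
open import Data.List.Relation.Unary.Linked.Properties using (Linked⇒All; Linked⇒AllPairs)
open import Data.List.Relation.Binary.Permutation.Propositional.Properties using (↭-reverse; map⁺)
open import Data.Product using (_,_)
open import Data.Sum as Sum using (_⊎_; inj₁; inj₂)
open import Function using (flip; _∘_)
open import Relation.Binary using (Rel; tri<; tri≈; tri>)
open import Relation.Binary.PropositionalEquality
open import Relation.Nullary using (contradiction)

L-positive : ∀ n → 0 < L n
L-positive 0 = s≤s z≤n
L-positive 1 = s≤s z≤n
L-positive (suc (suc n)) = ≤-trans (L-positive (suc n)) (m≤m+n _ _)

L-mono : ∀ {m n} → m ≤ n → L (suc m) ≤ L (suc n)
L-mono = mono′ ∘ ≤⇒≤′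
  where
  mono′ : ∀ {m n} → m ≤′ n → L (suc m) ≤ L (suc n)
  mono′ ≤′-refl = ≤-refl
  mono′ (≤′-step m≤′n) = ≤-trans (mono′ m≤′n) (m≤m+n _ _)

sumL : List ℕ → ℕ
sumL I = sum (map L I)

sumL-reverse : ∀ I → sumL (reverse I) ≡ sumL I
sumL-reverse I = sum-↭ (map⁺ L (↭-reverse I))

sumL-positive : ∀ x I → 0 < sumL (x ∷ I)
sumL-positive x I = ≤-trans (L-positive x) (m≤m+n _ _)

All-reverse : ∀ {P : ℕ → Set} {xs} → All P xs → All P (reverse xs)
All-reverse p = All.tabulate (All.lookup p ∘ reverse⁻)

AllPairs-reverse : ∀ {R : Rel ℕ _} {xs} → AllPairs R xs → AllPairs (flip R) (reverse xs)
AllPairs-reverse [] = []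
AllPairs-reverse {R} {x ∷ xs} (Rx ∷ Rxs) =
  subst (AllPairs (flip R)) (sym (unfold-reverse x xs))
    (AllPairs.++⁺ (AllPairs-reverse Rxs) ([] ∷ []) (All.map (_∷ []) (All-reverse Rx)))

_≪_ : Rel ℕ _
m ≪ n = suc m < n

_≫_ : Rel ℕ _
_≫_ = flip _≪_

≪-trans : ∀ {i j k} → i ≪ j → j ≪ k → i ≪ k
≪-trans {j = j} i≪j j≪k = <-trans i≪j (<-trans (n<1+n j) j≪k)

Sparse : List ℕ → Set
Sparse = Linked _≪_

Positive : List ℕ → Set
Positive = All (0 <_)

nonConsecutive⇒sparse : ∀ {I} → Linked _<_ I → NonConsecutive I → Sparse I
nonConsecutive⇒sparse [] _ = []
nonConsecutive⇒sparse [-] _ = [-]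
nonConsecutive⇒sparse (x<y ∷ l) nc =
  ≤∧≢⇒< x<y (λ 1+x≡y → nc (here refl) (there (here 1+x≡y)))
    ∷ nonConsecutive⇒sparse l (λ i∈ 1+i∈ → nc (there i∈) (there 1+i∈))

sparse-head-< : ∀ {x xs} → Sparse (x ∷ xs) → All (x <_) xs
sparse-head-< [-] = []
sparse-head-< (x≪y ∷ l) = All.map (<-trans (n<1+n _)) (Linked⇒All ≪-trans x≪y l)

descending-sumL-< : ∀ {x D} → AllPairs _≫_ (x ∷ D) → Positive (x ∷ D) →
                    sumL (x ∷ D) < L (suc x)
descending-sumL-< {zero} {[]} _ (() ∷ _)
descending-sumL-< {suc k} {[]} _ _ = +-monoʳ-< (L (suc k)) (L-positive k)
descending-sumL-< {suc (suc k)} ((s≤s (s≤s y≤k) ∷ _) ∷ D↓) (_ ∷ D⁺) =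
  +-monoʳ-< (L (suc (suc k))) (<-≤-trans (descending-sumL-< D↓ D⁺) (L-mono y≤k))

descending-sumL-<-head : ∀ {x y D E} → x < y → AllPairs _≫_ (x ∷ D) → Positive (x ∷ D) →
                         sumL (x ∷ D) < sumL (y ∷ E)
descending-sumL-<-head {y = suc y} {E = E} (s≤s x≤y) D↓ D⁺ =
  <-≤-trans (descending-sumL-< D↓ D⁺) (≤-trans (L-mono x≤y) (m≤m+n _ (sumL E)))

descending-injective : ∀ {D E} → AllPairs _≫_ D → AllPairs _≫_ E → Positive D → Positive E →
                       sumL D ≡ sumL E → D ≡ E
descending-injective {[]} {[]} _ _ _ _ _ = refl
descending-injective {[]} {y ∷ E} _ _ _ _ eq = contradiction eq (<⇒≢ (sumL-positive y E))
descending-injective {x ∷ D} {[]} _ _ _ _ eq = contradiction (sym eq) (<⇒≢ (sumL-positive x D))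
descending-injective {x ∷ D} {y ∷ E} D↓ E↓ D⁺ E⁺ eq with <-cmp x y
... | tri< x<y _ _ = contradiction eq (<⇒≢ (descending-sumL-<-head {E = E} x<y D↓ D⁺))
... | tri> _ _ y<x = contradiction (sym eq) (<⇒≢ (descending-sumL-<-head {E = D} y<x E↓ E⁺))
... | tri≈ _ refl _ = cong (x ∷_)
  (descending-injective (AllPairs.drop⁺ 1 D↓) (AllPairs.drop⁺ 1 E↓) (All.tail D⁺) (All.tail E⁺)
    (+-cancelˡ-≡ (L x) _ _ eq))

positive-sparse-injective : ∀ {I J} → Sparse I → Sparse J → Positive I → Positive J →
                            sumL I ≡ sumL J → I ≡ J
positive-sparse-injective {I} {J} I↑ J↑ I⁺ J⁺ eq = reverse-injective
  (descending-injective (reverse↓ I↑) (reverse↓ J↑) (All-reverse I⁺) (All-reverse J⁺)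
    (trans (sumL-reverse I) (trans eq (sym (sumL-reverse J)))))
  where
  reverse↓ : ∀ {K} → Sparse K → AllPairs _≫_ (reverse K)
  reverse↓ = AllPairs-reverse ∘ Linked⇒AllPairs ≪-trans

startsWithZero : List ℕ → Bool
startsWithZero (zero ∷ _) = true
startsWithZero _ = false

sparse-positive : ∀ {I} → Sparse I → startsWithZero I ≡ false → Positive I
sparse-positive {[]} _ _ = []
sparse-positive {suc k ∷ I} I↑ _ = s≤s z≤n ∷ All.map (<-trans z<s) (sparse-head-< I↑)

sparse-injective : ∀ {I J} b → startsWithZero I ≡ b → startsWithZero J ≡ b →
                   Sparse I → Sparse J → sumL I ≡ sumL J → I ≡ J
sparse-injective false I₀ J₀ I↑ J↑ eq =
  positive-sparse-injective I↑ J↑ (sparse-positive I↑ I₀) (sparse-positive J↑ J₀) eq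
sparse-injective {zero ∷ I} {zero ∷ J} true _ _ I↑ J↑ eq = cong (0 ∷_)
  (positive-sparse-injective (Linked.tail I↑) (Linked.tail J↑)
    (sparse-head-< I↑) (sparse-head-< J↑) (+-cancelˡ-≡ 2 _ _ eq))
sparse-injective {[]} true () _ _ _ _
sparse-injective {suc _ ∷ _} true () _ _ _ _
sparse-injective {zero ∷ _} {[]} true _ () _ _ _
sparse-injective {zero ∷ _} {suc _ ∷ _} true _ () _ _ _

Bool-pigeonhole : (a b c : Bool) → a ≡ b ⊎ a ≡ c ⊎ b ≡ c
Bool-pigeonhole true true _ = inj₁ refl
Bool-pigeonhole false false _ = inj₁ refl
Bool-pigeonhole true false true = inj₂ (inj₁ refl)
Bool-pigeonhole false true false = inj₂ (inj₁ refl)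
Bool-pigeonhole true false false = inj₂ (inj₂ refl)
Bool-pigeonhole false true true = inj₂ (inj₂ refl)

theorem1p3 : (N : ℕ) (I J K : List ℕ) →
    NonConsecutivePartition N I →
    NonConsecutivePartition N J →
    NonConsecutivePartition N K →
    I ≡ J ⊎ I ≡ K ⊎ J ≡ K
theorem1p3 N I J K (I↑ , I-nc , I-sum) (J↑ , J-nc , J-sum) (K↑ , K-nc , K-sum) =
  Sum.map (same I↑ I-nc I-sum J↑ J-nc J-sum)
    (Sum.map (same I↑ I-nc I-sum K↑ K-nc K-sum) (same J↑ J-nc J-sum K↑ K-nc K-sum))
    (Bool-pigeonhole (startsWithZero I) (startsWithZero J) (startsWithZero K))
  where
  same : ∀ {A B} → IsFinSet A → NonConsecutive A → sumL A ≡ N →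
         IsFinSet B → NonConsecutive B → sumL B ≡ N →
         startsWithZero A ≡ startsWithZero B → A ≡ B
  same A↑ A-nc A-sum B↑ B-nc B-sum A₀≡B₀ =
    sparse-injective _ A₀≡B₀ refl (nonConsecutive⇒sparse A↑ A-nc) (nonConsecutive⇒sparse B↑ B-nc)
      (trans A-sum (sym B-sum))
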